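{- Let $S$ be a finite set with $|S|=n$, let $\sigma$ be a dihedral structure on $S$, and let $D=D_{S_1|S_2}$ be an irreducible boundary divisor of $\overline{\mathcal{M}}_{0,S}$. Then $\mathbb{I}_D(\sigma)\leq \frac n2-1$, with equality if and only if $D$ is at finite distance with respect to $\sigma$.
   Context: Irreducible boundary divisors $D_{S_1|S_2}$ of the Deligne–Mumford–Knudsen compactification $\overline{\mathcal{M}}_{0,S}$ correspond to partitions $S=S_1\sqcup S_2$ with $|S_1|,|S_2|\geq 2$. A dihedral structure $\sigma$ on $S$ is a cyclic ordering modulo reversal, written as a cyclic sequence $(\sigma(1),\dots,\sigma(n))$, indices mod $n$. $D_{S_1|S_2}$ is at finite distance with respect to $\sigma$ if the elements of $S_1$ (equivalently $S_2$) are consecutive for $\sigma$. For $i,j\in S$ set $\mathbb I_D(i,j)=\frac12\big(\mathbb I(\{i,j\}\subseteq S_1)+\mathbb I(\{i,j\}\subseteq S_2)\big)$, where $\mathbb I(\cdot)$ is the indicator function, and $\mathbb I_D(\sigma)=\sum_{i\in\mathbb Z/n}\mathbb I_D(\sigma(i),\sigma(i+1))$. -}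

module Defs where

open import Data.Bool using (Bool; true; false; _∧_; not)
open import Data.Nat using (ℕ; zero; suc; _∸_; _<_; _≤_) renaming (_+_ to _+ℕ_)
open import Data.Nat.DivMod using (_%_; m%n<n)
open import Data.Fin using (Fin; toℕ; fromℕ<)
open import Data.Fin.Subset using (Subset; ∁; ∣_∣)
open import Data.Fin.Permutation using (Permutation′; _⟨$⟩ʳ_)
open import Data.Vec using (lookup)
open import Data.List using (List; foldr; map; allFin)
open import Data.Product using (Σ; _×_; _,_)
open import Data.Rational using (ℚ; 0ℚ; 1ℚ; ½; _+_; _*_)
open import Relation.Binary.PropositionalEquality using (_≡_)
open import Data.Unit using (⊤)
open import Function.Bundles using (_⇔_)

-- The finite set S with |S| = n is modelled as Fin n.
-- A dihedral structure is represented by a bijection σ : Fin n → S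
-- (i ↦ σ(i)), indices taken mod n; the quantities below are invariant
-- under rotation and reversal, so quantifying over all representatives
-- is the same as quantifying over dihedral structures.
Dihedral : ℕ → Set
Dihedral n = Permutation′ n

next : ∀ {n} → Fin n → Fin n
next {suc m} i = fromℕ< (m%n<n (suc (toℕ i)) (suc m))

𝕀 : Bool → ℚ
𝕀 true  = 1ℚ
𝕀 false = 0ℚ

-- The boundary divisor D_{S₁|S₂} is given by S₁ ⊆ S, with S₂ = S ∖ S₁.
-- Irreducible boundary divisor: |S₁| ≥ 2 and |S₂| ≥ 2.
IsBoundaryDivisor : ∀ {n} → Subset n → Set
IsBoundaryDivisor S₁ = (2 ≤ ∣ S₁ ∣) × (2 ≤ ∣ ∁ S₁ ∣)

𝕀D : ∀ {n} → Subset n → Fin n → Fin n → ℚ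
𝕀D S₁ i j =
  ½ * (𝕀 (lookup S₁ i ∧ lookup S₁ j) + 𝕀 (lookup (∁ S₁) i ∧ lookup (∁ S₁) j))

Σℚ : ∀ n → (Fin n → ℚ) → ℚ
Σℚ n f = foldr _+_ 0ℚ (map f (allFin n))

𝕀Dσ : ∀ {n} → Subset n → Dihedral n → ℚ
𝕀Dσ {n} S₁ σ = Σℚ n (λ i → 𝕀D S₁ (σ ⟨$⟩ʳ i) (σ ⟨$⟩ʳ next i))

-- D_{S₁|S₂} is at finite distance w.r.t. σ: the elements of S₁ are
-- consecutive for σ, i.e. S₁ = {σ(a), σ(a+1), …, σ(a+k-1)} for some
-- a ∈ ℤ/n and k ∈ ℕ (indices mod n).
FiniteDistance : ∀ {n} → Subset n → Dihedral n → Set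
FiniteDistance {zero} S₁ σ = ⊤
FiniteDistance {suc m} S₁ σ =
  Σ (Fin (suc m)) λ a → Σ ℕ λ k → (i : Fin (suc m)) →
    (lookup S₁ (σ ⟨$⟩ʳ i) ≡ true) ⇔ ((toℕ i +ℕ (suc m ∸ toℕ a)) % suc m < k)

-- Record, for i ∈ ℤ/n, whether σ(i) lies in S₁: this is a cyclic Boolean word of length n.
-- A pair (σ(i), σ(i+1)) contributes ½ to 𝕀_D(σ) exactly when the word does not change value
-- there, so 𝕀_D(σ) = a/2, where a + c = n and c is the number of changes around the cycle.
-- Going once around the cycle returns to the starting value, so c is even, and c ≠ 0 because
-- both S₁ and S₂ are nonempty. Hence c ≥ 2, i.e. 𝕀_D(σ) ≤ n/2 - 1, with equality iff c = 2.
-- Finally, a cyclic word with exactly two changes is a rotation of 1…10…0, which says precisely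
-- that the elements of S₁ are consecutive for σ.
module Submission where

open import Defs
open import Data.Bool using (Bool; true; false; not; _xor_; _∧_)
open import Data.Fin using (Fin; zero; suc; toℕ; fromℕ<)
open import Data.Nat as ℕ using (ℕ; zero; suc)
open import Data.Product using (Σ; ∃; ∃-syntax; _×_; _,_; map₂)
open import Function.Bundles using (_⇔_; mk⇔; Equivalence)
open import Relation.Binary.PropositionalEquality

module BooleanSequences where

  open import Data.Nat
  open import Data.Nat.Properties
  open import Data.Bool.Properties using (xor-same; T-≡)
  open import Relation.Nullary.Reflects using (Reflects; ofʸ; ofⁿ; det; fromEquivalence)
  open import Algebra.Properties.CommutativeSemigroup +-commutativeSemigroup using (interchange)
  open import Data.Nat.Tactic.RingSolver using (solve-∀)
  open import Data.Empty using (⊥-elim)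
  open import Function using (_∘_)
  open Equivalence using (to; from)

  sumTo : (ℕ → ℕ) → ℕ → ℕ
  sumTo t zero    = 0
  sumTo t (suc n) = t 0 + sumTo (λ j → t (suc j)) n

  sumTo-snoc : ∀ t n → sumTo t (suc n) ≡ sumTo t n + t n
  sumTo-snoc t zero    = +-comm (t 0) 0
  sumTo-snoc t (suc n) = trans (cong (t 0 +_) (sumTo-snoc (λ j → t (suc j)) n)) (sym (+-assoc (t 0) _ _))

  sumTo-cong : ∀ {t u} n → (∀ j → j < n → t j ≡ u j) → sumTo t n ≡ sumTo u n
  sumTo-cong zero    eq = refl
  sumTo-cong (suc n) eq = cong₂ _+_ (eq 0 z<s) (sumTo-cong n (λ j j<n → eq (suc j) (s<s j<n)))

  sumTo-shift : ∀ t n → t n ≡ t 0 → sumTo (λ j → t (suc j)) n ≡ sumTo t n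
  sumTo-shift t n tn≡t0 = +-cancelˡ-≡ (t 0) _ _ (begin
    t 0 + sumTo (λ j → t (suc j)) n ≡⟨ sumTo-snoc t n ⟩
    sumTo t n + t n                 ≡⟨ cong (sumTo t n +_) tn≡t0 ⟩
    sumTo t n + t 0                 ≡⟨ +-comm (sumTo t n) (t 0) ⟩
    t 0 + sumTo t n                 ∎)
    where open ≡-Reasoning

  sumTo-rotate : ∀ t n → (∀ j → t (j + n) ≡ t j) → ∀ a → sumTo (λ j → t (a + j)) n ≡ sumTo t n
  sumTo-rotate t n periodic zero    = refl
  sumTo-rotate t n periodic (suc a) =
    trans (sumTo-rotate (λ j → t (suc j)) n (λ j → periodic (suc j)) a) (sumTo-shift t n (periodic 0))

  𝕀ℕ : Bool → ℕ
  𝕀ℕ true  = 1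
  𝕀ℕ false = 0

  𝕀ℕ≤1 : ∀ b → 𝕀ℕ b ≤ 1
  𝕀ℕ≤1 true  = s≤s z≤n
  𝕀ℕ≤1 false = z≤n

  𝕀ℕ[x⊕y]≡0⇒x≡y : ∀ x y → 𝕀ℕ (x xor y) ≡ 0 → x ≡ y
  𝕀ℕ[x⊕y]≡0⇒x≡y true  true  _ = refl
  𝕀ℕ[x⊕y]≡0⇒x≡y false false _ = refl

  changes : (ℕ → Bool) → ℕ → ℕ
  changes g = sumTo (λ j → 𝕀ℕ (g j xor g (suc j)))

  agreements : (ℕ → Bool) → ℕ → ℕ
  agreements g = sumTo (λ j → 𝕀ℕ (not (g j xor g (suc j))))

  agreements+changes≡n : ∀ g n → agreements g n + changes g n ≡ n
  agreements+changes≡n g zero    = refl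
  agreements+changes≡n g (suc n) =
    trans (interchange (𝕀ℕ (not b)) (agreements (λ j → g (suc j)) n) (𝕀ℕ b) (changes (λ j → g (suc j)) n))
          (cong₂ _+_ (𝕀ℕ-not b) (agreements+changes≡n (λ j → g (suc j)) n))
    where
    b : Bool
    b = g 0 xor g 1
    𝕀ℕ-not : ∀ b → 𝕀ℕ (not b) + 𝕀ℕ b ≡ 1
    𝕀ℕ-not true  = refl
    𝕀ℕ-not false = refl

  changes-snoc : ∀ g n → changes g (suc n) ≡ changes g n + 𝕀ℕ (g n xor g (suc n))
  changes-snoc g = sumTo-snoc (λ j → 𝕀ℕ (g j xor g (suc j)))

  changes-cong : ∀ {g h} n → (∀ j → j ≤ n → g j ≡ h j) → changes g n ≡ changes h n
  changes-cong n eq = sumTo-cong n (λ j j<n → cong₂ (λ x y → 𝕀ℕ (x xor y)) (eq j (<⇒≤ j<n)) (eq (suc j) j<n))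

  changes-const : ∀ b n → changes (λ _ → b) n ≡ 0
  changes-const b zero    = refl
  changes-const b (suc n) = cong₂ _+_ (cong 𝕀ℕ (xor-same b)) (changes-const b n)

  changes-rotate : ∀ g n → (∀ j → g (j + n) ≡ g j) → ∀ a → changes (λ j → g (a + j)) n ≡ changes g n
  changes-rotate g n periodic a = trans
    (sumTo-cong n (λ j _ → cong (λ x → 𝕀ℕ (g (a + j) xor g x)) (+-suc a j)))
    (sumTo-rotate (λ j → 𝕀ℕ (g j xor g (suc j))) n
                  (λ j → cong₂ (λ x y → 𝕀ℕ (x xor y)) (periodic j) (periodic (suc j))) a)

  changes-parity : ∀ g n → ∃[ q ] changes g n ≡ q + q + 𝕀ℕ (g 0 xor g n)
  changes-parity g zero = 0 , cong 𝕀ℕ (sym (xor-same (g 0)))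
  changes-parity g (suc n) with changes-parity g n
  ... | q , eq = q + d , (begin
    changes g (suc n)                               ≡⟨ changes-snoc g n ⟩
    changes g n + 𝕀ℕ (y xor z)                      ≡⟨ cong (_+ 𝕀ℕ (y xor z)) eq ⟩
    q + q + 𝕀ℕ (x xor y) + 𝕀ℕ (y xor z)              ≡⟨ +-assoc (q + q) _ _ ⟩
    q + q + (𝕀ℕ (x xor y) + 𝕀ℕ (y xor z))            ≡⟨ cong (q + q +_) (two-steps x y z) ⟩
    q + q + (𝕀ℕ (x xor z) + 2 * d)                  ≡⟨ regroup q d (𝕀ℕ (x xor z)) ⟩
    (q + d) + (q + d) + 𝕀ℕ (x xor z)                ∎)
    where
    open ≡-Reasoning
    x y z : Bool
    x = g 0
    y = g n
    z = g (suc n)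
    d : ℕ
    d = 𝕀ℕ ((x xor y) ∧ (y xor z))
    two-steps : ∀ x y z → 𝕀ℕ (x xor y) + 𝕀ℕ (y xor z) ≡ 𝕀ℕ (x xor z) + 2 * 𝕀ℕ ((x xor y) ∧ (y xor z))
    two-steps true  true  true  = refl
    two-steps true  true  false = refl
    two-steps true  false true  = refl
    two-steps true  false false = refl
    two-steps false true  true  = refl
    two-steps false true  false = refl
    two-steps false false true  = refl
    two-steps false false false = refl
    regroup : ∀ q d c → q + q + (c + 2 * d) ≡ (q + d) + (q + d) + c
    regroup = solve-∀

  changes-even : ∀ g n → g n ≡ g 0 → ∃[ q ] changes g n ≡ q + q
  changes-even g n closed with changes-parity g n
  ... | q , eq = q , (begin
    changes g n                   ≡⟨ eq ⟩
    q + q + 𝕀ℕ (g 0 xor g n)      ≡⟨ cong (λ x → q + q + 𝕀ℕ (g 0 xor x)) closed ⟩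
    q + q + 𝕀ℕ (g 0 xor g 0)      ≡⟨ cong (λ b → q + q + 𝕀ℕ b) (xor-same (g 0)) ⟩
    q + q + 0                     ≡⟨ +-identityʳ (q + q) ⟩
    q + q                         ∎)
    where open ≡-Reasoning

  changes≡0⇒constant : ∀ g n → changes g n ≡ 0 → ∀ j → j ≤ n → g j ≡ g 0
  changes≡0⇒constant g n       _    zero    _         = refl
  changes≡0⇒constant g (suc n) none (suc j) (s≤s j≤n) =
    trans (changes≡0⇒constant (λ j → g (suc j)) n (m+n≡0⇒n≡0 _ none) j j≤n)
          (sym (𝕀ℕ[x⊕y]≡0⇒x≡y (g 0) (g 1) (m+n≡0⇒m≡0 _ none)))

  changes-<ᵇ≤1 : ∀ k n → changes (_<ᵇ k) n ≤ 1
  changes-<ᵇ≤1 _             zero    = z≤n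
  changes-<ᵇ≤1 zero          (suc n) = ≤-trans (≤-reflexive (changes-const false (suc n))) z≤n
  changes-<ᵇ≤1 (suc zero)    (suc n) = ≤-reflexive (cong suc (changes-const false n))
  changes-<ᵇ≤1 (suc (suc k)) (suc n) = changes-<ᵇ≤1 (suc k) n

  changes≡1⇒prefix : ∀ g n → g 0 ≡ true → changes g n ≡ 1 → ∃[ k ] (∀ j → j ≤ n → g j ≡ (j <ᵇ k))
  changes≡1⇒prefix g zero    g0 ()
  changes≡1⇒prefix g (suc n) g0 one with g 1 in g1
  ... | true with k , prefix ← changes≡1⇒prefix (λ j → g (suc j)) n g1
                                (trans (cong (λ x → 𝕀ℕ (x xor true) + changes (λ j → g (suc j)) n) (sym g0)) one) =
    suc k , λ { zero _ → g0 ; (suc j) (s≤s j≤n) → prefix j j≤n }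
  ... | false = 1 , λ { zero _ → g0 ; (suc j) (s≤s j≤n) → trans (changes≡0⇒constant (λ j → g (suc j)) n rest j j≤n) g1 }
    where
    rest : changes (λ j → g (suc j)) n ≡ 0
    rest = suc-injective (trans (cong (λ x → 𝕀ℕ (x xor false) + changes (λ j → g (suc j)) n) (sym g0)) one)

  risingEdge : ∀ (g : ℕ → Bool) x d → g x ≡ false → g (x + d) ≡ true → ∃[ j ] g j ≡ false × g (suc j) ≡ true
  risingEdge g x zero    gx gx+d with () ← trans (sym gx) (trans (cong g (sym (+-identityʳ x))) gx+d)
  risingEdge g x (suc d) gx gx+d with g (suc x) in gsx
  ... | true  = x , gx , gsx
  ... | false = risingEdge g (suc x) d gsx (trans (cong g (sym (+-suc x d))) gx+d)

  reflects⇒≡true⇔ : ∀ {A : Set} {b} → Reflects A b → (b ≡ true ⇔ A)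
  reflects⇒≡true⇔ (ofʸ a)  = mk⇔ (λ _ → a) (λ _ → refl)
  reflects⇒≡true⇔ (ofⁿ ¬a) = mk⇔ (λ ()) (λ a → ⊥-elim (¬a a))

  ≡<ᵇ⇒⇔ : ∀ {b j k} → b ≡ (j <ᵇ k) → (b ≡ true ⇔ j < k)
  ≡<ᵇ⇒⇔ {j = j} {k} refl = reflects⇒≡true⇔ (<ᵇ-reflects-< j k)

  ⇔⇒≡<ᵇ : ∀ {b j k} → (b ≡ true ⇔ j < k) → b ≡ (j <ᵇ k)
  ⇔⇒≡<ᵇ {j = j} {k} b⇔j<k = det (fromEquivalence (to b⇔j<k ∘ to T-≡) (from T-≡ ∘ from b⇔j<k)) (<ᵇ-reflects-< j k)

module Remainders where

  open import Data.Nat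
  open import Data.Nat.Properties
  open import Data.Nat.DivMod using (_%_; %-distribˡ-+; m%n%n≡m%n; [m+n]%n≡m%n)

  [m%n+k]%n≡[m+k]%n : ∀ m k n .{{_ : NonZero n}} → (m % n + k) % n ≡ (m + k) % n
  [m%n+k]%n≡[m+k]%n m k n = begin
    (m % n + k) % n         ≡⟨ %-distribˡ-+ (m % n) k n ⟩
    (m % n % n + k % n) % n ≡⟨ cong (λ x → (x + k % n) % n) (m%n%n≡m%n m n) ⟩
    (m % n + k % n) % n     ≡⟨ sym (%-distribˡ-+ m k n) ⟩
    (m + k) % n             ∎
    where open ≡-Reasoning

  [k+m%n]%n≡[k+m]%n : ∀ k m n .{{_ : NonZero n}} → (k + m % n) % n ≡ (k + m) % n
  [k+m%n]%n≡[k+m]%n k m n =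
    trans (cong (_% n) (+-comm k (m % n))) (trans ([m%n+k]%n≡[m+k]%n m k n) (cong (_% n) (+-comm m k)))

  [a+m+[n∸a]]%n≡m%n : ∀ a m n .{{_ : NonZero n}} → a ≤ n → (a + m + (n ∸ a)) % n ≡ m % n
  [a+m+[n∸a]]%n≡m%n a m n a≤n = trans (cong (_% n) a+m+[n∸a]≡m+n) ([m+n]%n≡m%n m n)
    where
    open ≡-Reasoning
    a+m+[n∸a]≡m+n : a + m + (n ∸ a) ≡ m + n
    a+m+[n∸a]≡m+n = begin
      a + m + (n ∸ a)   ≡⟨ cong (_+ (n ∸ a)) (+-comm a m) ⟩
      m + a + (n ∸ a)   ≡⟨ +-assoc m a (n ∸ a) ⟩
      m + (a + (n ∸ a)) ≡⟨ cong (m +_) (m+[n∸m]≡n a≤n) ⟩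
      m + n             ∎

module CyclicSequences {m : ℕ} (p : Fin (suc m) → Bool) where

  open import Data.Nat
  open import Data.Nat.Properties
  open import Data.Nat.DivMod using (_%_; _mod_; m%n<n; m%n%n≡m%n; [m+n]%n≡m%n; m<n⇒m%n≡m)
  open import Data.Fin.Properties using (fromℕ<-cong; fromℕ<-toℕ; toℕ-fromℕ<; toℕ<n)
  open BooleanSequences
  open Remainders

  private
    n : ℕ
    n = suc m

  unroll : ℕ → Bool
  unroll k = p (k mod n)

  unroll-cong : ∀ x y → x % n ≡ y % n → unroll x ≡ unroll y
  unroll-cong x y eq = cong p (fromℕ<-cong _ _ eq (m%n<n x n) (m%n<n y n))

  unroll-periodic : ∀ x → unroll (x + n) ≡ unroll x
  unroll-periodic x = unroll-cong (x + n) x ([m+n]%n≡m%n x n)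

  unroll-toℕ : ∀ i → unroll (toℕ i) ≡ p i
  unroll-toℕ i = cong p (trans (fromℕ<-cong _ _ (m<n⇒m%n≡m (toℕ<n i)) _ (toℕ<n i)) (fromℕ<-toℕ i (toℕ<n i)))

  rotated : ℕ → ℕ → Bool
  rotated a j = unroll (a + j)

  cyclicChanges : ℕ
  cyclicChanges = changes unroll n

  -- For p = labels S₁ σ this is, by definition, FiniteDistance S₁ σ.
  IsArc : Set
  IsArc = Σ (Fin n) λ a → Σ ℕ λ k → (i : Fin n) → (p i ≡ true) ⇔ ((toℕ i + (n ∸ toℕ a)) % n < k)

  cyclicChanges-rotated : ∀ a → changes (rotated a) n ≡ cyclicChanges
  cyclicChanges-rotated = changes-rotate unroll n unroll-periodic

  cyclicChanges≡0⇒constant : cyclicChanges ≡ 0 → ∀ i → p i ≡ unroll 0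
  cyclicChanges≡0⇒constant none i =
    trans (sym (unroll-toℕ i)) (changes≡0⇒constant unroll n none (toℕ i) (<⇒≤ (toℕ<n i)))

  2≤cyclicChanges : ∀ {i i′} → p i ≡ true → p i′ ≡ false → 2 ≤ cyclicChanges
  2≤cyclicChanges {i} {i′} pi pi′ with changes-even unroll n (unroll-periodic 0)
  ... | suc q , eq = subst (2 ≤_) (sym eq) (+-mono-≤ (s≤s z≤n) (s≤s z≤n))
  ... | zero  , none with () ← trans (sym pi) (trans (cyclicChanges≡0⇒constant none i)
                                              (trans (sym (cyclicChanges≡0⇒constant none i′)) pi′))

  unroll-risingEdge : ∀ {i i′} → p i ≡ true → p i′ ≡ false → ∃[ j ] unroll j ≡ false × unroll (suc j) ≡ true
  unroll-risingEdge {i} {i′} pi pi′ =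
    risingEdge unroll (toℕ i′) (toℕ i + n ∸ toℕ i′) (trans (unroll-toℕ i′) pi′) (begin
      unroll (toℕ i′ + (toℕ i + n ∸ toℕ i′)) ≡⟨ cong unroll (m+[n∸m]≡n i′≤i+n) ⟩
      unroll (toℕ i + n)                    ≡⟨ unroll-periodic (toℕ i) ⟩
      unroll (toℕ i)                        ≡⟨ unroll-toℕ i ⟩
      p i                                   ≡⟨ pi ⟩
      true                                  ∎)
    where
    open ≡-Reasoning
    i′≤i+n : toℕ i′ ≤ toℕ i + n
    i′≤i+n = ≤-trans (<⇒≤ (toℕ<n i′)) (m≤n+m n (toℕ i))

  arc⇒prefix : ∀ a k → (∀ i → (p i ≡ true) ⇔ ((toℕ i + (n ∸ toℕ a)) % n < k)) →
               ∀ j → j ≤ m → rotated (toℕ a) j ≡ (j <ᵇ k)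
  arc⇒prefix a k arc j j≤m = ⇔⇒≡<ᵇ (subst (λ x → (p i ≡ true) ⇔ (x < k)) offset≡j (arc i))
    where
    open ≡-Reasoning
    i : Fin n
    i = (toℕ a + j) mod n
    offset≡j : (toℕ i + (n ∸ toℕ a)) % n ≡ j
    offset≡j = begin
      (toℕ i + (n ∸ toℕ a)) % n           ≡⟨ cong (λ x → (x + (n ∸ toℕ a)) % n) (toℕ-fromℕ< (m%n<n (toℕ a + j) n)) ⟩
      ((toℕ a + j) % n + (n ∸ toℕ a)) % n ≡⟨ [m%n+k]%n≡[m+k]%n (toℕ a + j) (n ∸ toℕ a) n ⟩
      (toℕ a + j + (n ∸ toℕ a)) % n       ≡⟨ [a+m+[n∸a]]%n≡m%n (toℕ a) j n (<⇒≤ (toℕ<n a)) ⟩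
      j % n                               ≡⟨ m<n⇒m%n≡m (s≤s j≤m) ⟩
      j                                   ∎

  prefix⇒arc : ∀ {a} → a < n → ∃[ k ] (∀ j → j ≤ m → rotated a j ≡ (j <ᵇ k)) → IsArc
  prefix⇒arc {a} a<n (k , prefix) = fromℕ< a<n , k , arcAt
    where
    arcAt : ∀ i → (p i ≡ true) ⇔ ((toℕ i + (n ∸ toℕ (fromℕ< a<n))) % n < k)
    arcAt i rewrite toℕ-fromℕ< a<n = ≡<ᵇ⇒⇔ (trans pi≡ (prefix j (s≤s⁻¹ (m%n<n (toℕ i + (n ∸ a)) n))))
      where
      open ≡-Reasoning
      j : ℕ
      j = (toℕ i + (n ∸ a)) % n
      pi≡ : p i ≡ rotated a j
      pi≡ = trans (sym (unroll-toℕ i)) (unroll-cong (toℕ i) (a + j) (sym (begin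
        (a + j) % n                 ≡⟨ [k+m%n]%n≡[k+m]%n a (toℕ i + (n ∸ a)) n ⟩
        (a + (toℕ i + (n ∸ a))) % n ≡⟨ cong (_% n) (sym (+-assoc a (toℕ i) (n ∸ a))) ⟩
        (a + toℕ i + (n ∸ a)) % n   ≡⟨ [a+m+[n∸a]]%n≡m%n a (toℕ i) n (<⇒≤ a<n) ⟩
        toℕ i % n                   ∎)))

  arc⇒cyclicChanges≡2 : ∀ {i i′} → p i ≡ true → p i′ ≡ false → IsArc → cyclicChanges ≡ 2
  arc⇒cyclicChanges≡2 pi pi′ (a , k , arc) = ≤-antisym cyclicChanges≤2 (2≤cyclicChanges pi pi′)
    where
    open ≤-Reasoning
    g : ℕ → Bool
    g = rotated (toℕ a)
    cyclicChanges≤2 : cyclicChanges ≤ 2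
    cyclicChanges≤2 = begin
      cyclicChanges                   ≡⟨ sym (cyclicChanges-rotated (toℕ a)) ⟩
      changes g n                     ≡⟨ changes-snoc g m ⟩
      changes g m + 𝕀ℕ (g m xor g n)  ≤⟨ +-mono-≤ (≤-trans (≤-reflexive (changes-cong m (arc⇒prefix a k arc)))
                                                           (changes-<ᵇ≤1 k m))
                                                 (𝕀ℕ≤1 (g m xor g n)) ⟩
      2                               ∎

  cyclicChanges≡2⇒arc : ∀ {i i′} → p i ≡ true → p i′ ≡ false → cyclicChanges ≡ 2 → IsArc
  cyclicChanges≡2⇒arc pi pi′ two with unroll-risingEdge pi pi′
  ... | j , uj , usj = prefix⇒arc (m%n<n (suc j) n) (changes≡1⇒prefix g m g0 one)
    where
    open ≡-Reasoning
    a : ℕ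
    a = suc j % n
    g : ℕ → Bool
    g = rotated a
    g0 : g 0 ≡ true
    g0 = trans (unroll-cong (a + 0) (suc j) (trans (cong (_% n) (+-identityʳ a)) (m%n%n≡m%n (suc j) n))) usj
    gm : g m ≡ false
    gm = trans (unroll-cong (a + m) j (trans ([m%n+k]%n≡[m+k]%n (suc j) m n)
                                   (trans (cong (_% n) (sym (+-suc j m))) ([m+n]%n≡m%n j n)))) uj
    gn : g n ≡ true
    gn = trans (unroll-periodic a) (trans (cong unroll (sym (+-identityʳ a))) g0)
    one : changes g m ≡ 1
    one = +-cancelʳ-≡ 1 (changes g m) 1 (begin
      changes g m + 1                  ≡⟨ cong₂ (λ x y → changes g m + 𝕀ℕ (x xor y)) (sym gm) (sym gn) ⟩
      changes g m + 𝕀ℕ (g m xor g n)   ≡⟨ sym (changes-snoc g m) ⟩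
      changes g n                      ≡⟨ cyclicChanges-rotated a ⟩
      cyclicChanges                    ≡⟨ two ⟩
      2                                ∎)

  cyclicChanges≡2⇔arc : ∀ {i i′} → p i ≡ true → p i′ ≡ false → (cyclicChanges ≡ 2 ⇔ IsArc)
  cyclicChanges≡2⇔arc pi pi′ = mk⇔ (cyclicChanges≡2⇒arc pi pi′) (arc⇒cyclicChanges≡2 pi pi′)

module Halves where

  import Data.Nat.Properties as ℕ
  open import Data.Integer as ℤ using (+_; -[1+_])
  import Data.Integer.Properties as ℤ
  open import Data.Integer.Tactic.RingSolver using (solve-∀)
  open import Data.Rational using (ℚ; _/_; _+_; _-_; 1ℚ; _≤_; fromℚᵘ)
  open import Data.Rational.Properties using (toℚᵘ-injective; toℚᵘ-homo-+; toℚᵘ-fromℚᵘ; fromℚᵘ-cong; toℚᵘ-cancel-≤; toℚᵘ-cong)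
  open import Data.Rational.Unnormalised as ℚᵘ using (mkℚᵘ; *≡*; *≤*)
  import Data.Rational.Unnormalised.Properties as ℚᵘ

  half : ℕ → ℚ
  half k = + k / 2

  fromℚᵘ-homo-+ : ∀ p q → fromℚᵘ (p ℚᵘ.+ q) ≡ fromℚᵘ p + fromℚᵘ q
  fromℚᵘ-homo-+ p q = toℚᵘ-injective (ℚᵘ.≃-trans (toℚᵘ-fromℚᵘ (p ℚᵘ.+ q))
    (ℚᵘ.≃-sym (ℚᵘ.≃-trans (toℚᵘ-homo-+ (fromℚᵘ p) (fromℚᵘ q)) (ℚᵘ.+-cong (toℚᵘ-fromℚᵘ p) (toℚᵘ-fromℚᵘ q)))))

  fromℚᵘ-mono-≤ : ∀ {p q} → p ℚᵘ.≤ q → fromℚᵘ p ≤ fromℚᵘ q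
  fromℚᵘ-mono-≤ {p} {q} p≤q =
    toℚᵘ-cancel-≤ (ℚᵘ.≤-respˡ-≃ (ℚᵘ.≃-sym (toℚᵘ-fromℚᵘ p)) (ℚᵘ.≤-respʳ-≃ (ℚᵘ.≃-sym (toℚᵘ-fromℚᵘ q)) p≤q))

  fromℚᵘ-cancel-≡ : ∀ {p q} → fromℚᵘ p ≡ fromℚᵘ q → p ℚᵘ.≃ q
  fromℚᵘ-cancel-≡ {p} {q} eq = ℚᵘ.≃-trans (ℚᵘ.≃-sym (toℚᵘ-fromℚᵘ p)) (ℚᵘ.≃-trans (toℚᵘ-cong eq) (toℚᵘ-fromℚᵘ q))

  half-+ : ∀ a b → half (a ℕ.+ b) ≡ half a + half b
  half-+ a b =
    trans (fromℚᵘ-cong {mkℚᵘ (+ (a ℕ.+ b)) 1} {mkℚᵘ (+ a) 1 ℚᵘ.+ mkℚᵘ (+ b) 1}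
                       (*≡* (sym (cross-multiplied (+ a) (+ b)))))
          (fromℚᵘ-homo-+ (mkℚᵘ (+ a) 1) (mkℚᵘ (+ b) 1))
    where
    cross-multiplied : ∀ x y → (x ℤ.* + 2 ℤ.+ y ℤ.* + 2) ℤ.* + 2 ≡ (x ℤ.+ y) ℤ.* (+ 2 ℤ.* + 2)
    cross-multiplied = solve-∀

  half[a+[2+d]]-1≡half[a+d] : ∀ a d → half (a ℕ.+ (2 ℕ.+ d)) - 1ℚ ≡ half (a ℕ.+ d)
  half[a+[2+d]]-1≡half[a+d] a d =
    trans (sym (fromℚᵘ-homo-+ (mkℚᵘ (+ (a ℕ.+ (2 ℕ.+ d))) 1) (mkℚᵘ -[1+ 0 ] 0)))
          (fromℚᵘ-cong {mkℚᵘ (+ (a ℕ.+ (2 ℕ.+ d))) 1 ℚᵘ.+ mkℚᵘ -[1+ 0 ] 0} {mkℚᵘ (+ (a ℕ.+ d)) 1}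
                       (*≡* (cross-multiplied (+ a) (+ d))))
    where
    cross-multiplied : ∀ x y → ((x ℤ.+ (+ 2 ℤ.+ y)) ℤ.* + 1 ℤ.+ -[1+ 0 ] ℤ.* + 2) ℤ.* + 2 ≡ (x ℤ.+ y) ℤ.* (+ 2 ℤ.* + 1)
    cross-multiplied = solve-∀

  half-mono-≤ : ∀ {a b} → a ℕ.≤ b → half a ≤ half b
  half-mono-≤ {a} {b} a≤b = fromℚᵘ-mono-≤ {mkℚᵘ (+ a) 1} {mkℚᵘ (+ b) 1} (*≤* (ℤ.*-monoʳ-≤-nonNeg (+ 2) (ℤ.+≤+ a≤b)))

  half-injective : ∀ {a b} → half a ≡ half b → a ≡ b
  half-injective {a} {b} eq with fromℚᵘ-cancel-≡ {mkℚᵘ (+ a) 1} {mkℚᵘ (+ b) 1} eq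
  ... | *≡* a*2≡b*2 = ℤ.+-injective (ℤ.*-cancelʳ-≡ (+ a) (+ b) (+ 2) a*2≡b*2)

  half-≤-n/2-1 : ∀ a c {n} → a ℕ.+ c ≡ n → 2 ℕ.≤ c →
                 (half a ≤ half n - 1ℚ) × ((half a ≡ half n - 1ℚ) ⇔ c ≡ 2)
  half-≤-n/2-1 a c a+c≡n 2≤c with ℕ.m≤n⇒∃[o]m+o≡n 2≤c
  ... | d , refl with refl ← a+c≡n rewrite half[a+[2+d]]-1≡half[a+d] a d =
    half-mono-≤ (ℕ.m≤m+n a d) ,
    mk⇔ (λ eq → cong (2 ℕ.+_) (ℕ.+-cancelˡ-≡ a d 0 (trans (sym (half-injective eq)) (sym (ℕ.+-identityʳ a)))))
        (λ 2+d≡2 → cong half (sym (trans (cong (a ℕ.+_) (ℕ.+-cancelˡ-≡ 2 d 0 2+d≡2)) (ℕ.+-identityʳ a))))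

open import Data.Integer using (+_)
open import Data.Rational as ℚ using (ℚ; _/_; _-_; 1ℚ; _≤_; 0ℚ; ½)
open import Data.Fin.Subset using (Subset; ∁; ∣_∣)
open import Data.Nat.Properties using (<⇒≤)
open import Data.Fin.Subset.Properties using (nonempty?; Empty-unique; ∣⊥∣≡0)
open import Data.Fin.Permutation using (_⟨$⟩ʳ_; _⟨$⟩ˡ_; inverseʳ)
open import Data.Vec using ([]; lookup)
open import Data.Vec.Properties using (lookup-map; []=⇒lookup)
open import Data.List using (foldr)
open import Data.List.Properties using (map-tabulate)
open import Data.Bool.Properties using (not-injective)
open import Function using (id; _∘_)
open import Function.Properties.Equivalence using () renaming (trans to ⇔-trans)
open import Relation.Nullary using (yes; no)
open BooleanSequences using (𝕀ℕ; sumTo; agreements; agreements+changes≡n)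
open Halves using (half; half-+; half-≤-n/2-1)

labels : ∀ {n} → Subset n → Dihedral n → Fin n → Bool
labels S₁ σ i = lookup S₁ (σ ⟨$⟩ʳ i)

1≤∣p∣⇒∃-member : ∀ {n} (p : Subset n) → 1 ℕ.≤ ∣ p ∣ → ∃ λ x → lookup p x ≡ true
1≤∣p∣⇒∃-member {n} p 1≤∣p∣ with nonempty? p
... | yes (x , x∈p) = x , []=⇒lookup x∈p
... | no  ¬nonempty with () ← subst (1 ℕ.≤_) (trans (cong ∣_∣ (Empty-unique ¬nonempty)) (∣⊥∣≡0 n)) 1≤∣p∣

labels-both-values : ∀ {n} (S₁ : Subset n) (σ : Dihedral n) → IsBoundaryDivisor S₁ →
                     (∃ λ i → labels S₁ σ i ≡ true) × (∃ λ i′ → labels S₁ σ i′ ≡ false)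
labels-both-values S₁ σ (2≤∣S₁∣ , 2≤∣S₂∣)
  with x₁ , x₁∈S₁ ← 1≤∣p∣⇒∃-member S₁ (<⇒≤ 2≤∣S₁∣)
     | x₂ , x₂∈S₂ ← 1≤∣p∣⇒∃-member (∁ S₁) (<⇒≤ 2≤∣S₂∣) =
  (σ ⟨$⟩ˡ x₁ , trans (cong (lookup S₁) (inverseʳ σ)) x₁∈S₁) ,
  (σ ⟨$⟩ˡ x₂ , trans (cong (lookup S₁) (inverseʳ σ)) (not-injective (trans (sym (lookup-map x₂ not S₁)) x₂∈S₂)))

Σℚ-suc : ∀ n (h : Fin (suc n) → ℚ) → Σℚ (suc n) h ≡ h zero ℚ.+ Σℚ n (h ∘ suc)
Σℚ-suc n h = cong (λ xs → h zero ℚ.+ foldr ℚ._+_ 0ℚ xs) (trans (map-tabulate suc h) (sym (map-tabulate id (h ∘ suc))))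

Σℚ-half : ∀ n (h : Fin n → ℚ) e → (∀ i → h i ≡ half (e (toℕ i))) → Σℚ n h ≡ half (sumTo e n)
Σℚ-half zero    h e eq = refl
Σℚ-half (suc n) h e eq = begin
  Σℚ (suc n) h                                  ≡⟨ Σℚ-suc n h ⟩
  h zero ℚ.+ Σℚ n (h ∘ suc)                      ≡⟨ cong₂ ℚ._+_ (eq zero) (Σℚ-half n (h ∘ suc) (e ∘ suc) (eq ∘ suc)) ⟩
  half (e 0) ℚ.+ half (sumTo (e ∘ suc) n)        ≡⟨ sym (half-+ (e 0) _) ⟩
  half (sumTo e (suc n))                          ∎
  where open ≡-Reasoning

𝕀D≡half-agreement : ∀ {n} (S₁ : Subset n) x y → 𝕀D S₁ x y ≡ half (𝕀ℕ (not (lookup S₁ x xor lookup S₁ y)))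
𝕀D≡half-agreement S₁ x y =
  trans (cong₂ (λ u v → ½ ℚ.* (𝕀 (lookup S₁ x ∧ lookup S₁ y) ℚ.+ 𝕀 (u ∧ v))) (lookup-map x not S₁) (lookup-map y not S₁))
        (agreement (lookup S₁ x) (lookup S₁ y))
  where
  agreement : ∀ b c → ½ ℚ.* (𝕀 (b ∧ c) ℚ.+ 𝕀 (not b ∧ not c)) ≡ half (𝕀ℕ (not (b xor c)))
  agreement true  true  = refl
  agreement true  false = refl
  agreement false true  = refl
  agreement false false = refl

𝕀Dσ≡half-agreements : ∀ {m} (S₁ : Subset (suc m)) (σ : Dihedral (suc m)) →
                      𝕀Dσ S₁ σ ≡ half (agreements (CyclicSequences.unroll (labels S₁ σ)) (suc m))
𝕀Dσ≡half-agreements {m} S₁ σ = Σℚ-half (suc m) _ (λ j → 𝕀ℕ (not (unroll j xor unroll (suc j)))) λ i →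
  -- next i is suc (toℕ i) mod (suc m), so σ ⟨$⟩ʳ next i has label unroll (suc (toℕ i)) by definition.
  trans (𝕀D≡half-agreement S₁ (σ ⟨$⟩ʳ i) (σ ⟨$⟩ʳ next i))
        (cong (λ b → half (𝕀ℕ (not (b xor unroll (suc (toℕ i)))))) (sym (unroll-toℕ i)))
  where open CyclicSequences (labels S₁ σ)

lemma3p8 : (n : ℕ) (S₁ : Subset n) (σ : Dihedral n) → IsBoundaryDivisor S₁ →
    (𝕀Dσ S₁ σ ≤ (+ n / 2) - 1ℚ) × ((𝕀Dσ S₁ σ ≡ (+ n / 2) - 1ℚ) ⇔ FiniteDistance S₁ σ)
lemma3p8 zero    [] σ (() , _)
lemma3p8 (suc m) S₁ σ D rewrite 𝕀Dσ≡half-agreements S₁ σ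
  with (_ , inside) , (_ , outside) ← labels-both-values S₁ σ D =
  map₂ (λ tight → ⇔-trans tight (cyclicChanges≡2⇔arc inside outside))
       (half-≤-n/2-1 (agreements unroll (suc m)) cyclicChanges
                     (agreements+changes≡n unroll (suc m)) (2≤cyclicChanges inside outside))
  where open CyclicSequences (labels S₁ σ)
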